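{- Let $\mathcal{X}$ be a connected $n$-premaniplex with base flag $x_0$, $N=\mathrm{Stab}_{\mathcal{C}^n}(x_0)$, and let $(\mathcal{Y},\eta)$ be an $(n,m)$-voltage operator with $\mathcal{Y}$ connected, base flag $y_0$, $L=\mathrm{Stab}_{\mathcal{C}^m}(y_0)$ and $\zeta:L\to\mathcal{C}^n$, $\zeta(\omega)=\eta(P_\omega(y_0))$. Suppose $\mathcal{X}\rtimes_\eta\mathcal{Y}$ is connected. Then for $\omega\in\mathcal{C}^m$ there is an automorphism $\alpha_\omega$ of $\mathcal{X}\rtimes_\eta\mathcal{Y}$ with $(x_0,y_0)\alpha_\omega=\omega(x_0,y_0)$ if and only if $\omega\in\mathrm{Norm}_{\mathcal{C}^m}(\zeta^{ -1}(N))$; moreover $\mathrm{Aut}(\mathcal{X}\rtimes_\eta\mathcal{Y})\cong\mathrm{Norm}_{\mathcal{C}^m}(\zeta^{ -1}(N))/\zeta^{ -1}(N)$.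
   Context: A graph may have multiple edges and semi-edges. An $n$-premaniplex is such a graph with edges coloured by $\{0,\dots,n-1\}$ so that every vertex (flag) is the starting point of exactly one dart of each colour, and whenever $|i-j|\ge2$ every alternating path of length 4 with colours $i,j$ is closed; $x^i$ is the end of the $i$-dart at $x$. $\mathcal{C}^n=\langle r_0,\dots,r_{n-1}\mid r_i^2=1,\ (r_ir_j)^2=1\ (|i-j|\ge2)\rangle$ acts on the left on flags by $r_ix=x^i$; $\mathrm{Stab}$ denotes stabilisers and $\mathrm{Norm}$ normalisers. Automorphisms are bijections of flags preserving all $i$-adjacencies, acting on the right. For a flag $y$ of an $m$-premaniplex $\mathcal{Y}$ and $\omega\in\mathcal{C}^m$, $P_\omega(y)$ is the homotopy class of paths from $y$ whose successive colours $i_1,\dots,i_k$ satisfy $r_{i_k}\cdots r_{i_1}=\omega$ (homotopic iff same start and same element of $\mathcal{C}^m$); they end at $\omega y$; these form the fundamental groupoid $\Pi(\mathcal{Y})$. A voltage assignment $\eta:\Pi(\mathcal{Y})\to\mathcal{C}^n$ satisfies $\eta(W_1W_2)=\eta(W_2)\eta(W_1)$; $(\mathcal{Y},\eta)$ is an $(n,m)$-voltage operator. $\mathcal{X}\rtimes_\eta\mathcal{Y}$ is the $m$-premaniplex with flags $\mathcal{X}\times\mathcal{Y}$ and $(x,y)^i=(\eta(P_{r_i}(y))x,y^i)$, so $\omega(x,y)=(\eta(P_\omega(y))x,\omega y)$. Standing assumption: $\mathcal{Y}$ has a spanning tree all of whose darts have trivial voltage. -}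

module Defs where

open import Data.Nat using (ℕ; suc; _≤_; _+_)
open import Data.Fin using (Fin; toℕ)
open import Data.List using (List; []; _∷_; _++_; reverse; [_])
open import Data.Product using (Σ; ∃; _×_; _,_; proj₁)
open import Data.Sum using (_⊎_)
open import Relation.Binary.PropositionalEquality using (_≡_)
open import Function.Definitions using (Bijective)

-- A word (a₁ ∷ a₂ ∷ … ∷ aₖ ∷ []) denotes r_{a₁} r_{a₂} ⋯ r_{aₖ};
-- group multiplication is concatenation _++_, and C^n is the quotient
-- of words by the congruence _~_ generated by the defining relations.

Word : ℕ → Set
Word n = List (Fin n)

Far : ∀ {n} → Fin n → Fin n → Set
Far i j = (2 + toℕ i ≤ toℕ j) ⊎ (2 + toℕ j ≤ toℕ i)

infix 4 _~_
data _~_ {n : ℕ} : Word n → Word n → Set where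
  ~-refl  : ∀ {u} → u ~ u
  ~-sym   : ∀ {u v} → u ~ v → v ~ u
  ~-trans : ∀ {u v w} → u ~ v → v ~ w → u ~ w
  ~-cong  : ∀ {u u' v v'} → u ~ u' → v ~ v' → u ++ v ~ u' ++ v'
  ~-inv   : ∀ i → (i ∷ i ∷ []) ~ []
  ~-comm  : ∀ i j → Far i j → (i ∷ j ∷ i ∷ j ∷ []) ~ []

-- inverse in C^n (each generator is an involution)
winv : ∀ {n} → Word n → Word n
winv = reverse

-- n-coloured graphs (every flag has exactly one i-dart, ending at adj i x)

record Graph (n : ℕ) : Set₁ where
  field
    Flag : Set
    adj  : Fin n → Flag → Flag

  act : Word n → Flag → Flag
  act []      x = x
  act (i ∷ w) x = adj i (act w x)

  Connected : Set
  Connected = ∀ x y → ∃ λ (w : Word n) → act w x ≡ y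

record Aut {n : ℕ} (G : Graph n) : Set where
  open Graph G
  field
    map   : Flag → Flag
    map-adj : ∀ i x → map (adj i x) ≡ adj i (map x)
    map-bij : Bijective _≡_ _≡_ map

_≈Aut_ : ∀ {n} {G : Graph n} → Aut G → Aut G → Set
_≈Aut_ {G = G} α β = ∀ x → Aut.map α x ≡ Aut.map β x

record Premaniplex (n : ℕ) : Set₁ where
  field
    graph : Graph n
  open Graph graph public
  field
    adj-invol : ∀ i x → adj i (adj i x) ≡ x
    adj-alt   : ∀ i j → Far i j → ∀ x → adj i (adj j (adj i (adj j x))) ≡ x

-- (n,m)-voltage operators.  The homotopy class P_ω(y) is determined by
-- (y, ω); η y ω stands for η(P_ω(y)).  W₁ = P_ω(y) followed by
-- W₂ = P_ω'(ω y) is P_{ω'ω}(y), and η(W₁W₂) = η(W₂)η(W₁).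

record VoltageOperator (n m : ℕ) : Set₁ where
  field
    Y : Premaniplex m
  open Premaniplex Y public
  field
    η      : Flag → Word m → Word n
    η-resp : ∀ y {ω ω'} → ω ~ ω' → η y ω ~ η y ω'
    η-comp : ∀ y ω ω' → η y (ω' ++ ω) ~ (η (act ω y) ω' ++ η y ω)

-- Standing assumption: Y has a spanning tree all of whose darts have
-- trivial voltage.  Stated as: a connected spanning set of darts
-- (closed under reversal) with trivial voltages.
-- paths in Y using only darts from a dart set T
data TPath {m : ℕ} (G : Graph m) (T : Graph.Flag G → Fin m → Set)
     : Graph.Flag G → Graph.Flag G → Set where
  here : ∀ {y} → TPath G T y y
  step : ∀ {y z} i → T y i → TPath G T (Graph.adj G i y) z → TPath G T y z

record TrivialSpanningTree {n m : ℕ} (V : VoltageOperator n m) : Set₁ where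
  open VoltageOperator V
  field
    T      : Flag → Fin m → Set
    T-rev  : ∀ y i → T y i → T (adj i y) i
    T-triv : ∀ y i → T y i → η y [ i ] ~ []
    T-spanning : ∀ y z → TPath graph T y z

-- X ⋊_η Y as an m-coloured graph: (x,y)^i = (η(P_{r_i}(y)) x , y^i)
_⋊_ : ∀ {n m} → Premaniplex n → VoltageOperator n m → Graph m
X ⋊ V = record
  { Flag = Premaniplex.Flag X × VoltageOperator.Flag V
  ; adj  = λ i xy → ( Premaniplex.act X (VoltageOperator.η V (Data.Product.proj₂ xy) [ i ]) (proj₁ xy)
                    , VoltageOperator.adj V i (Data.Product.proj₂ xy)) }

-- K = ζ⁻¹(N) ≤ L ≤ C^m, with N = Stab(x₀), L = Stab(y₀), ζ ω = η(P_ω(y₀))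

module _ {n m : ℕ} (X : Premaniplex n) (V : VoltageOperator n m)
         (x₀ : Premaniplex.Flag X) (y₀ : VoltageOperator.Flag V) where
  private
    module X = Premaniplex X
    module V = VoltageOperator V

  InL : Word m → Set
  InL ω = V.act ω y₀ ≡ y₀

  InN : Word n → Set
  InN g = X.act g x₀ ≡ x₀

  -- ω ∈ ζ⁻¹(N)  (ζ is only defined on L)
  InK : Word m → Set
  InK ω = InL ω × InN (V.η y₀ ω)

  InNorm : Word m → Set
  InNorm ω = (∀ κ → InK κ → InK (ω ++ κ ++ winv ω))
           × (∀ κ → InK κ → Σ (Word m) λ κ' → InK κ' × (κ ~ ω ++ κ' ++ winv ω))

  SameCoset : Word m → Word m → Set
  SameCoset ω ω' = InK (winv ω ++ ω')

  -- Norm(K)/K ≅ Aut(X ⋊ V), where automorphisms act on the right: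
  -- (z)(αβ) = ((z)α)β.  An isomorphism is a well-defined, multiplicative,
  -- injective and surjective map on coset representatives.
  record NormQuotientIso : Set where
    field
      Φ : (ω : Word m) → InNorm ω → Aut (X ⋊ V)
      Φ-wd   : ∀ ω ω' (p : InNorm ω) (p' : InNorm ω') →
               SameCoset ω ω' → Φ ω p ≈Aut Φ ω' p'
      Φ-hom  : ∀ ω ω' (p : InNorm ω) (p' : InNorm ω') (q : InNorm (ω ++ ω')) →
               ∀ z → Aut.map (Φ (ω ++ ω') q) z ≡ Aut.map (Φ ω' p') (Aut.map (Φ ω p) z)
      Φ-inj  : ∀ ω ω' (p : InNorm ω) (p' : InNorm ω') →
               Φ ω p ≈Aut Φ ω' p' → SameCoset ω ω'
      Φ-surj : ∀ (α : Aut (X ⋊ V)) → Σ (Word m) λ ω → Σ (InNorm ω) λ p → Φ ω p ≈Aut α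

{-# OPTIONS --safe #-}
-- C^m acts on the flags of X ⋊_η Y by ω (x , y) = (η(P_ω y) x , ω y), so the stabiliser of
-- (x₀ , y₀) is exactly ζ⁻¹(N). In a connected premaniplex an automorphism is determined by
-- the image of one flag, and z₀ can be sent to z' by an automorphism iff z₀ and z' have the
-- same stabiliser. As Stab(ω z₀) = ω Stab(z₀) ω⁻¹, the flag ω z₀ qualifies iff ω normalises
-- Stab(z₀), and ω ↦ (the automorphism sending z₀ to ω z₀) induces Norm(K)/K ≅ Aut.
module Submission where

open import Defs
open import Data.Nat using (ℕ)
open import Level using (0ℓ)
open import Data.List using ([]; _∷_; _++_; [_])
open import Data.List.Properties using (unfold-reverse; reverse-involutive; ++-assoc; ++-identityʳ)
open import Data.Product using (Σ; _×_; _,_; proj₁; proj₂)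
open import Relation.Binary.Bundles using (Setoid)
open import Relation.Binary.Structures using (IsEquivalence)
open import Relation.Binary.PropositionalEquality hiding ([_])
open import Function.Bundles using (_⇔_; mk⇔; Equivalence)
import Relation.Binary.Reasoning.Setoid as SetoidReasoning

≡⇒~ : ∀ {n} {u v : Word n} → u ≡ v → u ~ v
≡⇒~ refl = ~-refl

~-isEquivalence : ∀ {n} → IsEquivalence (_~_ {n})
~-isEquivalence = record { refl = ~-refl ; sym = ~-sym ; trans = ~-trans }

~-setoid : ℕ → Setoid 0ℓ 0ℓ
~-setoid n = record { isEquivalence = ~-isEquivalence {n} }

module ~-Reasoning {n} = SetoidReasoning (~-setoid n)

++-winv : ∀ {n} (u : Word n) → u ++ winv u ~ []
++-winv [] = ~-refl
++-winv (i ∷ u) = begin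
  i ∷ u ++ winv (i ∷ u)        ≡⟨ cong (λ v → i ∷ u ++ v) (unfold-reverse i u) ⟩
  i ∷ u ++ (winv u ++ [ i ])   ≡⟨ cong (i ∷_) (++-assoc u (winv u) [ i ]) ⟨
  [ i ] ++ (u ++ winv u) ++ [ i ] ≈⟨ ~-cong (~-refl {u = [ i ]}) (~-cong (++-winv u) ~-refl) ⟩
  i ∷ i ∷ []                   ≈⟨ ~-inv i ⟩
  []                           ∎
  where open ~-Reasoning

winv-++ : ∀ {n} (u : Word n) → winv u ++ u ~ []
winv-++ u = subst (λ v → winv u ++ v ~ []) (reverse-involutive u) (++-winv (winv u))

conj : ∀ {n} → Word n → Word n → Word n
conj ω κ = ω ++ κ ++ winv ω

conj-winv : ∀ {n} (ω κ : Word n) → conj ω (winv ω ++ κ ++ ω) ~ κ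
conj-winv ω κ = begin
  ω ++ (winv ω ++ κ ++ ω) ++ winv ω   ≡⟨ regroup ⟩
  (ω ++ winv ω) ++ κ ++ ω ++ winv ω   ≈⟨ ~-cong (++-winv ω) (~-cong ~-refl (++-winv ω)) ⟩
  κ ++ []                             ≡⟨ ++-identityʳ κ ⟩
  κ                                   ∎
  where
  open ~-Reasoning
  regroup : ω ++ (winv ω ++ κ ++ ω) ++ winv ω ≡ (ω ++ winv ω) ++ κ ++ ω ++ winv ω
  regroup = trans (cong (ω ++_) (++-assoc (winv ω) (κ ++ ω) (winv ω)))
            (trans (sym (++-assoc ω (winv ω) ((κ ++ ω) ++ winv ω)))
                   (cong (λ v → (ω ++ winv ω) ++ v) (++-assoc κ ω (winv ω))))

idempotent⇒~[] : ∀ {n} {g : Word n} → g ~ g ++ g → g ~ []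
idempotent⇒~[] {g = g} idem = begin
  g                      ≈⟨ ~-cong (winv-++ g) ~-refl ⟨
  (winv g ++ g) ++ g     ≡⟨ ++-assoc (winv g) g g ⟩
  winv g ++ g ++ g       ≈⟨ ~-cong ~-refl idem ⟨
  winv g ++ g            ≈⟨ winv-++ g ⟩
  []                     ∎
  where open ~-Reasoning

Normalises : ∀ {m} → (Word m → Set) → Word m → Set
Normalises {m} H ω = (∀ κ → H κ → H (conj ω κ))
               × (∀ κ → H κ → Σ (Word m) λ κ' → H κ' × (κ ~ conj ω κ'))

module GraphAction {m} (G : Graph m) where
  open Graph G

  act-++ : ∀ u v x → act (u ++ v) x ≡ act u (act v x)
  act-++ []      v x = refl
  act-++ (i ∷ u) v x = cong (adj i) (act-++ u v x)

  AdjPreserving : (Flag → Flag) → Set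
  AdjPreserving f = ∀ i x → f (adj i x) ≡ adj i (f x)

  ∘-adjPreserving : ∀ {f g} → AdjPreserving f → AdjPreserving g → AdjPreserving (λ x → g (f x))
  ∘-adjPreserving {f} {g} pf pg i x = trans (cong g (pf i x)) (pg i (f x))

  adjPreserving-act : ∀ {f} → AdjPreserving f → ∀ u x → f (act u x) ≡ act u (f x)
  adjPreserving-act pf []      x = refl
  adjPreserving-act pf (i ∷ u) x = trans (pf i (act u x)) (cong (adj i) (adjPreserving-act pf u x))

module PremaniplexAction {m} (P : Premaniplex m) where
  open Premaniplex P
  open GraphAction graph public

  act-resp : ∀ {u v} → u ~ v → ∀ x → act u x ≡ act v x
  act-resp ~-refl          x = refl
  act-resp (~-sym p)       x = sym (act-resp p x)
  act-resp (~-trans p q)   x = trans (act-resp p x) (act-resp q x)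
  act-resp (~-cong {u} {u'} {v} {v'} p q) x = begin
    act (u ++ v) x      ≡⟨ act-++ u v x ⟩
    act u (act v x)     ≡⟨ act-resp p (act v x) ⟩
    act u' (act v x)    ≡⟨ cong (act u') (act-resp q x) ⟩
    act u' (act v' x)   ≡⟨ act-++ u' v' x ⟨
    act (u' ++ v') x    ∎
    where open ≡-Reasoning
  act-resp (~-inv i)       x = adj-invol i x
  act-resp (~-comm i j f)  x = adj-alt i j f x

  act-winv-act : ∀ u x → act (winv u) (act u x) ≡ x
  act-winv-act u x = trans (sym (act-++ (winv u) u x)) (act-resp (winv-++ u) x)

  act-act-winv : ∀ u x → act u (act (winv u) x) ≡ x
  act-act-winv u x = trans (sym (act-++ u (winv u) x)) (act-resp (++-winv u) x)

  act-injective : ∀ u {x y} → act u x ≡ act u y → x ≡ y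
  act-injective u {x} {y} e =
    trans (sym (act-winv-act u x)) (trans (cong (act (winv u)) e) (act-winv-act u y))

  Stab : Flag → Word m → Set
  Stab x κ = act κ x ≡ x

  stab-resp : ∀ {x κ κ'} → κ ~ κ' → Stab x κ → Stab x κ'
  stab-resp {x} p s = trans (sym (act-resp p x)) s

  stab-conj : ∀ {x} ω κ → Stab x κ → Stab (act ω x) (conj ω κ)
  stab-conj {x} ω κ s = begin
    act (ω ++ κ ++ winv ω) (act ω x)        ≡⟨ act-++ ω (κ ++ winv ω) _ ⟩
    act ω (act (κ ++ winv ω) (act ω x))     ≡⟨ cong (act ω) (act-++ κ (winv ω) _) ⟩
    act ω (act κ (act (winv ω) (act ω x)))  ≡⟨ cong (λ y → act ω (act κ y)) (act-winv-act ω x) ⟩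
    act ω (act κ x)                         ≡⟨ cong (act ω) s ⟩
    act ω x                                 ∎
    where open ≡-Reasoning

  stab-unconj : ∀ {x} ω κ → Stab (act ω x) κ → Stab x (winv ω ++ κ ++ ω)
  stab-unconj {x} ω κ s = begin
    act (winv ω ++ κ ++ ω) x          ≡⟨ act-++ (winv ω) (κ ++ ω) x ⟩
    act (winv ω) (act (κ ++ ω) x)     ≡⟨ cong (act (winv ω)) (trans (act-++ κ ω x) s) ⟩
    act (winv ω) (act ω x)            ≡⟨ act-winv-act ω x ⟩
    x                                 ∎
    where open ≡-Reasoning

  act≡act⇒stab : ∀ u v x → act u x ≡ act v x → Stab x (winv v ++ u)
  act≡act⇒stab u v x e = trans (act-++ (winv v) u x) (trans (cong (act (winv v)) e) (act-winv-act v x))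

  stab⇒act≡act : ∀ u v x → Stab x (winv v ++ u) → act u x ≡ act v x
  stab⇒act≡act u v x s =
    trans (sym (act-act-winv v (act u x))) (cong (act v) (trans (sym (act-++ (winv v) u x)) s))

  SameStab : Flag → Flag → Set
  SameStab x y = ∀ κ → Stab x κ ⇔ Stab y κ

  sameStab-act≡ : ∀ {x y} → SameStab x y → ∀ u v → act u x ≡ act v x → act u y ≡ act v y
  sameStab-act≡ {x} {y} same u v e =
    stab⇒act≡act u v y (Equivalence.to (same (winv v ++ u)) (act≡act⇒stab u v x e))

  sameStab-sym : ∀ {x y} → SameStab x y → SameStab y x
  sameStab-sym same κ = mk⇔ (Equivalence.from (same κ)) (Equivalence.to (same κ))

  aut-sameStab : (α : Aut graph) → ∀ x → SameStab x (Aut.map α x)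
  aut-sameStab α x κ = mk⇔
    (λ s → trans (sym (α-act κ x)) (cong map s))
    (λ s → proj₁ map-bij (trans (α-act κ x) s))
    where
    open Aut α
    α-act : ∀ u x → map (act u x) ≡ act u (map x)
    α-act = adjPreserving-act map-adj

  normalises⇔sameStab : ∀ {H : Word m → Set} {z} → (∀ κ → H κ ⇔ Stab z κ) →
                        ∀ ω → Normalises H ω ⇔ SameStab z (act ω z)
  normalises⇔sameStab {H} {z} H⇔Stab ω = mk⇔ toSameStab toNormalises
    where
    toH : ∀ κ → Stab z κ → H κ
    toH κ = Equivalence.from (H⇔Stab κ)
    fromH : ∀ κ → H κ → Stab z κ
    fromH κ = Equivalence.to (H⇔Stab κ)

    toSameStab : Normalises H ω → SameStab z (act ω z)
    toSameStab (conj-closed , conj-onto) κ = mk⇔ forward backward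
      where
      forward : Stab z κ → Stab (act ω z) κ
      forward s with conj-onto κ (toH κ s)
      ... | κ' , hκ' , κ~ = stab-resp (~-sym κ~) (stab-conj ω κ' (fromH κ' hκ'))
      backward : Stab (act ω z) κ → Stab z κ
      backward s = stab-resp (conj-winv ω κ)
        (fromH (conj ω κ') (conj-closed κ' (toH κ' (stab-unconj ω κ s))))
        where
        κ' : Word m
        κ' = winv ω ++ κ ++ ω

    toNormalises : SameStab z (act ω z) → Normalises H ω
    toNormalises same = conj-closed , conj-onto
      where
      conj-closed : ∀ κ → H κ → H (conj ω κ)
      conj-closed κ h = toH (conj ω κ) (Equivalence.from (same (conj ω κ)) (stab-conj ω κ (fromH κ h)))
      conj-onto : ∀ κ → H κ → Σ (Word m) λ κ' → H κ' × (κ ~ conj ω κ')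
      conj-onto κ h = winv ω ++ κ ++ ω
                    , toH (winv ω ++ κ ++ ω) (stab-unconj ω κ (Equivalence.to (same κ) (fromH κ h)))
                    , ~-sym (conj-winv ω κ)

  module Connected (conn : Connected) (z₀ : Flag) where

    path : Flag → Word m
    path z = proj₁ (conn z₀ z)

    path-act : ∀ z → act (path z) z₀ ≡ z
    path-act z = proj₂ (conn z₀ z)

    adjPreserving-unique : ∀ {f g} → AdjPreserving f → AdjPreserving g →
                           f z₀ ≡ g z₀ → ∀ z → f z ≡ g z
    adjPreserving-unique {f} {g} pf pg e z = begin
      f z                    ≡⟨ cong f (path-act z) ⟨
      f (act (path z) z₀)    ≡⟨ adjPreserving-act pf (path z) z₀ ⟩
      act (path z) (f z₀)    ≡⟨ cong (act (path z)) e ⟩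
      act (path z) (g z₀)    ≡⟨ adjPreserving-act pg (path z) z₀ ⟨
      g (act (path z) z₀)    ≡⟨ cong g (path-act z) ⟩
      g z                    ∎
      where open ≡-Reasoning

    autTo : ∀ z' → SameStab z₀ z' → Aut graph
    autTo z' same = record { map = φ ; map-adj = φ-adj ; map-bij = φ-injective , φ-surjective }
      where
      φ : Flag → Flag
      φ z = act (path z) z'

      φ-adj : AdjPreserving φ
      φ-adj i z = sameStab-act≡ same (path (adj i z)) (i ∷ path z)
                    (trans (path-act (adj i z)) (cong (adj i) (sym (path-act z))))

      φ-injective : ∀ {a b} → φ a ≡ φ b → a ≡ b
      φ-injective {a} {b} e = trans (sym (path-act a))
        (trans (sameStab-act≡ (sameStab-sym same) (path a) (path b) e) (path-act b))

      φ-surjective : ∀ t → Σ Flag λ s → ∀ {z} → z ≡ s → φ z ≡ t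
      φ-surjective t = s , λ { refl → trans (sameStab-act≡ same (path s) u (path-act s)) (proj₂ (conn z' t)) }
        where
        u : Word m
        u = proj₁ (conn z' t)
        s : Flag
        s = act u z₀

    autTo-base : ∀ z' same → Aut.map (autTo z' same) z₀ ≡ z'
    autTo-base z' same = sameStab-act≡ same (path z₀) [] (path-act z₀)

    ∃aut⇔sameStab : ∀ z' → (Σ (Aut graph) λ α → Aut.map α z₀ ≡ z') ⇔ SameStab z₀ z'
    ∃aut⇔sameStab z' = mk⇔
      (λ { (α , refl) → aut-sameStab α z₀ })
      (λ same → autTo z' same , autTo-base z' same)

module _ {n m} (X : Premaniplex n) (V : VoltageOperator n m) where
  private
    module X = Premaniplex X
    module XA = PremaniplexAction X
    module V = VoltageOperator V
    module YA = PremaniplexAction V.Y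
    module Z = Graph (X ⋊ V)

  η-identity : ∀ y → V.η y [] ~ []
  η-identity y = idempotent⇒~[] (V.η-comp y [] [])

  act-⋊ : ∀ ω x y → Z.act ω (x , y) ≡ (X.act (V.η y ω) x , V.act ω y)
  act-⋊ []      x y = cong (_, y) (sym (XA.act-resp (η-identity y) x))
  act-⋊ (i ∷ ω) x y = trans (cong (Z.adj i) (act-⋊ ω x y)) (cong (_, V.act (i ∷ ω) y) (sym η-step))
    where
    η-step : X.act (V.η y (i ∷ ω)) x ≡ X.act (V.η (V.act ω y) [ i ]) (X.act (V.η y ω) x)
    η-step = trans (XA.act-resp (V.η-comp y ω [ i ]) x) (XA.act-++ (V.η (V.act ω y) [ i ]) (V.η y ω) x)

  ⋊-act-resp : ∀ {u v} → u ~ v → ∀ z → Z.act u z ≡ Z.act v z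
  ⋊-act-resp {u} {v} p (x , y) = trans (act-⋊ u x y)
    (trans (cong₂ _,_ (XA.act-resp (V.η-resp y p) x) (YA.act-resp p y)) (sym (act-⋊ v x y)))

  ⋊-premaniplex : Premaniplex m
  ⋊-premaniplex = record
    { graph     = X ⋊ V
    ; adj-invol = λ i → ⋊-act-resp (~-inv i)
    ; adj-alt   = λ i j far → ⋊-act-resp (~-comm i j far)
    }

  open PremaniplexAction ⋊-premaniplex

  InK⇔stab : ∀ x₀ y₀ κ → InK X V x₀ y₀ κ ⇔ Stab (x₀ , y₀) κ
  InK⇔stab x₀ y₀ κ = mk⇔
    (λ { (inL , inN) → trans (act-⋊ κ x₀ y₀) (cong₂ _,_ inN inL) })
    (λ s → let e = trans (sym (act-⋊ κ x₀ y₀)) s in cong proj₂ e , cong proj₁ e)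

  module _ (x₀ : X.Flag) (y₀ : V.Flag) (conn : Graph.Connected (X ⋊ V)) where
    open Connected conn (x₀ , y₀)
    open Z using (act)

    z₀ : Z.Flag
    z₀ = (x₀ , y₀)

    inNorm⇔sameStab : ∀ ω → InNorm X V x₀ y₀ ω ⇔ SameStab z₀ (act ω z₀)
    inNorm⇔sameStab = normalises⇔sameStab (InK⇔stab x₀ y₀)

    ∃aut⇔inNorm : ∀ ω → (Σ (Aut (X ⋊ V)) λ α → Aut.map α z₀ ≡ act ω z₀) ⇔ InNorm X V x₀ y₀ ω
    ∃aut⇔inNorm ω = mk⇔
      (λ a → Equivalence.from (inNorm⇔sameStab ω) (Equivalence.to (∃aut⇔sameStab (act ω z₀)) a))
      (λ p → Equivalence.from (∃aut⇔sameStab (act ω z₀)) (Equivalence.to (inNorm⇔sameStab ω) p))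

    Φ : ∀ ω → InNorm X V x₀ y₀ ω → Aut (X ⋊ V)
    Φ ω p = autTo (act ω z₀) (Equivalence.to (inNorm⇔sameStab ω) p)

    Φ-base : ∀ ω p → Aut.map (Φ ω p) z₀ ≡ act ω z₀
    Φ-base ω p = autTo-base (act ω z₀) (Equivalence.to (inNorm⇔sameStab ω) p)

    sameCoset⇔act≡ : ∀ ω ω' → SameCoset X V x₀ y₀ ω ω' ⇔ (act ω' z₀ ≡ act ω z₀)
    sameCoset⇔act≡ ω ω' = mk⇔
      (λ k → stab⇒act≡act ω' ω z₀ (Equivalence.to (InK⇔stab x₀ y₀ _) k))
      (λ e → Equivalence.from (InK⇔stab x₀ y₀ _) (act≡act⇒stab ω' ω z₀ e))

    normQuotientIso : NormQuotientIso X V x₀ y₀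
    normQuotientIso = record
      { Φ      = Φ
      ; Φ-wd   = λ ω ω' p p' sc → adjPreserving-unique (map-adj (Φ ω p)) (map-adj (Φ ω' p'))
                   (trans (Φ-base ω p) (trans (sym (Equivalence.to (sameCoset⇔act≡ ω ω') sc)) (sym (Φ-base ω' p'))))
      ; Φ-hom  = λ ω ω' p p' q → adjPreserving-unique (map-adj (Φ (ω ++ ω') q))
                   (∘-adjPreserving (map-adj (Φ ω p)) (map-adj (Φ ω' p'))) (hom-base ω ω' p p' q)
      ; Φ-inj  = λ ω ω' p p' h → Equivalence.from (sameCoset⇔act≡ ω ω')
                   (trans (sym (Φ-base ω' p')) (trans (sym (h z₀)) (Φ-base ω p)))
      ; Φ-surj = surj
      }
      where
      open Aut

      hom-base : ∀ ω ω' p p' q → map (Φ (ω ++ ω') q) z₀ ≡ map (Φ ω' p') (map (Φ ω p) z₀)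
      hom-base ω ω' p p' q = begin
        map (Φ (ω ++ ω') q) z₀              ≡⟨ Φ-base (ω ++ ω') q ⟩
        act (ω ++ ω') z₀                    ≡⟨ act-++ ω ω' z₀ ⟩
        act ω (act ω' z₀)                   ≡⟨ cong (act ω) (Φ-base ω' p') ⟨
        act ω (map (Φ ω' p') z₀)            ≡⟨ adjPreserving-act (map-adj (Φ ω' p')) ω z₀ ⟨
        map (Φ ω' p') (act ω z₀)            ≡⟨ cong (map (Φ ω' p')) (Φ-base ω p) ⟨
        map (Φ ω' p') (map (Φ ω p) z₀)      ∎
        where open ≡-Reasoning

      surj : ∀ α → Σ (Word m) λ ω → Σ (InNorm X V x₀ y₀ ω) λ p → Φ ω p ≈Aut α
      surj α = ω , p , adjPreserving-unique (map-adj (Φ ω p)) (map-adj α)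
                         (trans (Φ-base ω p) (path-act (map α z₀)))
        where
        ω : Word m
        ω = path (map α z₀)
        p : InNorm X V x₀ y₀ ω
        p = Equivalence.to (∃aut⇔inNorm ω) (α , sym (path-act (map α z₀)))

corollary5p3 : ∀ {n m} (X : Premaniplex n) (V : VoltageOperator n m)
    → TrivialSpanningTree V
    → Premaniplex.Connected X → VoltageOperator.Connected V
    → (x₀ : Premaniplex.Flag X) (y₀ : VoltageOperator.Flag V)
    → Graph.Connected (X ⋊ V)
    → ((ω : Word m) →
         (Σ (Aut (X ⋊ V)) (λ α → Aut.map α (x₀ , y₀) ≡ Graph.act (X ⋊ V) ω (x₀ , y₀)))
           ⇔ InNorm X V x₀ y₀ ω)
      × NormQuotientIso X V x₀ y₀
corollary5p3 X V _ _ _ x₀ y₀ conn = ∃aut⇔inNorm X V x₀ y₀ conn , normQuotientIso X V x₀ y₀ conn
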